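{- Let $a\in\mathbb{A}$ and $u\in\mathbb{A}^n$. Then for $A=\{a\}$ we have $\mu(d_A(u))\le\mu(u)+1$.
   Context: $\mathbb{A}$ is a finite nonempty alphabet. For $u=u_1\cdots u_n$, $u[i,j]=u_i\cdots u_j$; $\mathcal{S}(n)=\{(i,j)\mid 1\le i\le j\le n\}$; $\mathrm{alph}(u)$ is the set of letters of $u$. A set $S\subseteq\mathcal{S}(n)$ palindromically generates $u\in\mathbb{A}^n$ if (1) $u[i,j]$ is a palindrome for all $(i,j)\in S$, and (2) for every nonempty set $\mathbb{B}$ and every $v\in\mathbb{B}^n$ with $v[i,j]$ a palindrome for all $(i,j)\in S$, there is a map $c\colon\mathrm{alph}(u)\to\mathbb{B}$ whose extension to a morphism satisfies $c(u)=v$. $\mu(w)$ is the minimal cardinality of a set palindromically generating $w$ ($+\infty$ if none, with $+\infty+1=+\infty$). For $A\subseteq\mathbb{A}$, $d_A$ is the morphism with $d_A(a)=aa$ if $a\in A$ and $d_A(a)=a$ otherwise. -}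

module Defs where

open import Data.Nat using (ℕ; suc; _∸_; _≤_)
open import Data.Fin using (Fin)
open import Data.Fin.Properties using () renaming (_≟_ to _≟ᶠ_)
open import Data.List using (List; []; _∷_; length; take; drop; reverse; map; concatMap)
open import Data.List.Membership.Propositional using (_∈_)
open import Data.List.Relation.Unary.Unique.Propositional using (Unique)
open import Data.Product using (Σ; _×_; _,_)
open import Data.Bool using (if_then_else_)
open import Relation.Nullary.Decidable using (does)
open import Relation.Binary.PropositionalEquality using (_≡_)

Alphabet : ℕ → Set
Alphabet k = Fin (suc k)

-- u[i,j] = u_i ... u_j, positions 1-indexed.
factor : {X : Set} → List X → ℕ → ℕ → List X
factor w i j = take (suc j ∸ i) (drop (i ∸ 1) w)

Palindrome : {X : Set} → List X → Set
Palindrome w = reverse w ≡ w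

InS : ℕ → ℕ × ℕ → Set
InS n (i , j) = (1 ≤ i) × (i ≤ j) × (j ≤ n)

-- A finite set S ⊆ S(n) represented as a duplicate-free list; |S| = length.
-- Every factor indexed by S is a palindrome.
PalOn : {X : Set} → List (ℕ × ℕ) → List X → Set
PalOn S w = ∀ {p} → p ∈ S → Palindrome (factor w (Data.Product.proj₁ p) (Data.Product.proj₂ p))

PalGenerates : {k : ℕ} → List (ℕ × ℕ) → List (Alphabet k) → Set₁
PalGenerates {k} S u =
  Unique S ×
  (∀ {p} → p ∈ S → InS (length u) p) ×
  PalOn S u ×
  (∀ (B : Set) → B → (v : List B) → length v ≡ length u → PalOn S v →
     Σ (Alphabet k → B) λ c → map c u ≡ v)

μ≤ : {k : ℕ} → List (Alphabet k) → ℕ → Set₁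
μ≤ w m = Σ (List (ℕ × ℕ)) λ S → PalGenerates S w × (length S ≤ m)

d : {k : ℕ} → Alphabet k → List (Alphabet k) → List (Alphabet k)
d a = concatMap (λ x → if does (x ≟ᶠ a) then x ∷ x ∷ [] else x ∷ [])

module Submission where

-- The word d(u) is the concatenation of the blocks x^m(x), where m(a) = 2 and m(x) = 1 otherwise;
-- a window (i, j) on u is sent to the window of d(u) covering the blocks of u[i, j].  Cut a word v
-- that is palindromic on the image windows into blocks of the same lengths: every window of u then
-- reads, in blocks, the same backwards once each block is reversed.  If all blocks of v are
-- constant, the word of their first letters is palindromic on the windows of u, hence equals c(u),
-- and v = c(d(u)).  Blocks of length one are constant, and a palindrome of length two is constant.
-- To see that every doubled block is a palindrome, add the window {p} for one occurrence p of a
-- (the "+1"): its block is then a palindrome.  Mark it and close the marking under the reflections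
-- in all windows of u.  Reflections carry palindromic blocks to reversed, hence palindromic, blocks,
-- and the closed marking is a Boolean word palindromic on the windows of u, hence of the form c(u)
-- with c(a) true: every occurrence of a is marked.

open import Defs
open import Data.Nat using (ℕ; zero; suc; _+_; _∸_; _≤_; _<_; z≤n; s≤s)
open import Data.Nat.Properties
  using (≤-refl; ≤-trans; m<m+n; _≟_; ≤-reflexive; +-suc; +-monoʳ-≤; m≤m+n; n≤1+n; m+n∸m≡n; m+[n∸m]≡n; m≤n⇒m⊓n≡m; m≤n⇒m≤1+n; suc-injective; +-assoc)
open import Data.Nat.ListAction using (sum)
open import Data.List
  using (List; []; _∷_; _++_; zipWith; foldr; deduplicate; length; take; drop; reverse; map; concat; concatMap; replicate; _∷ʳ_)
open import Data.List.Properties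
  using (length-++; take-[]; length-deduplicate; ≡-dec; ++-cancelˡ; ++-cancelʳ; map-id; length-take; length-drop; length-map; take++drop≡id; take-map; drop-map; map-∘;
         map-cong; map-id-local; map-replicate; concat-map; length-reverse; length-replicate; reverse-++; unfold-reverse; reverse-map; reverse-involutive; ++-identityʳ; concat-++;
         ∷-injective; ∷-injectiveˡ; ∷-injectiveʳ)
open import Data.List.Relation.Binary.Pointwise as Pointwise using (Pointwise; []; _∷_; Pointwise-length; Pointwise-≡⇒≡; ++⁺; reverse⁺)
import Data.List.Relation.Binary.Pointwise.Properties as Pointwiseₚ
open import Data.List.Relation.Unary.All as All using (All; []; _∷_)
import Data.List.Relation.Unary.All.Properties as Allₚ
open import Data.List.Relation.Unary.AllPairs using (AllPairs; []; _∷_)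
open import Data.List.Membership.Propositional using (_∈_)
open import Data.List.Relation.Unary.Any using (here; there)
open import Data.List.Membership.Propositional.Properties using (∈-map⁺; ∈-map⁻; ∈-∃++; ∈-deduplicate⁺; ∈-deduplicate⁻)
open import Data.Fin.Properties using () renaming (_≟_ to _≟ᶠ_)
open import Data.Sum using (_⊎_; inj₁; inj₂)
open import Relation.Nullary.Decidable using (does)
open import Data.Product using (Σ; ∃₂; ∃-syntax; _×_; _,_; proj₁; proj₂)
open import Data.Bool using (Bool; true; false; _∨_; T; f≤t; b≤b; if_then_else_) renaming (_≤_ to _≤ᵇ_)
import Data.Bool.Properties as Bool
open import Data.Product.Properties using () renaming (≡-dec to ×-≡-dec)
open import Data.List.Relation.Unary.Unique.DecPropositional.Properties using (deduplicate-!)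
open import Data.Nat.GeneralisedArithmetic using (iterate)
open import Data.Nat.Induction using (<-wellFounded)
open import Induction.WellFounded using (Acc; acc)
open import Relation.Nullary using (Dec; yes; no)
open import Data.Empty using (⊥-elim)
open import Data.Unit using (tt)
open import Function using (_∘_; id)
open import Relation.Binary.PropositionalEquality

private variable
  A B C : Set

-- Lists of blocks


take-++ : (xs ys : List A) (n : ℕ) → take (length xs + n) (xs ++ ys) ≡ xs ++ take n ys
take-++ []       ys n = refl
take-++ (x ∷ xs) ys n = cong (x ∷_) (take-++ xs ys n)

drop-++ : (xs ys : List A) (n : ℕ) → drop (length xs + n) (xs ++ ys) ≡ drop n ys
drop-++ []       ys n = refl
drop-++ (x ∷ xs) ys n = drop-++ xs ys n

take-concat : ∀ t (bs : List (List A)) → take (sum (take t (map length bs))) (concat bs) ≡ concat (take t bs)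
take-concat zero    bs       = refl
take-concat (suc t) []       = refl
take-concat (suc t) (b ∷ bs) = trans (take-++ b (concat bs) _) (cong (b ++_) (take-concat t bs))

drop-concat : ∀ s (bs : List (List A)) → drop (sum (take s (map length bs))) (concat bs) ≡ concat (drop s bs)
drop-concat zero    bs       = refl
drop-concat (suc s) []       = refl
drop-concat (suc s) (b ∷ bs) = trans (drop-++ b (concat bs) _) (drop-concat s bs)

sum-take-+ : ∀ s t (ns : List ℕ) → sum (take (s + t) ns) ≡ sum (take s ns) + sum (take t (drop s ns))
sum-take-+ zero    t ns       = refl
sum-take-+ (suc s) t []       = sym (cong sum (take-[] t))
sum-take-+ (suc s) t (n ∷ ns) = trans (cong (n +_) (sum-take-+ s t ns)) (sym (+-assoc n _ _))

factor-concat : (bs : List (List A)) {i j : ℕ} → 1 ≤ i → i ≤ j →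
  factor (concat bs) (suc (sum (take (i ∸ 1) (map length bs)))) (sum (take j (map length bs)))
    ≡ concat (factor bs i j)
factor-concat bs {suc s} {j} _ i≤j =
  subst (λ j → factor (concat bs) (suc (L s)) (L j) ≡ concat (factor bs (suc s) j))
        (m+[n∸m]≡n (≤-trans (n≤1+n s) i≤j)) (aligned (j ∸ s))
  where
  open ≡-Reasoning
  ns = map length bs
  L : ℕ → ℕ
  L t = sum (take t ns)
  aligned : ∀ t → factor (concat bs) (suc (L s)) (L (s + t)) ≡ concat (factor bs (suc s) (s + t))
  aligned t = begin
    take (L (s + t) ∸ L s) (drop (L s) (concat bs))
      ≡⟨ cong₂ take (trans (cong (_∸ L s) (sum-take-+ s t ns)) (m+n∸m≡n (L s) _)) (drop-concat s bs) ⟩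
    take (sum (take t (drop s ns))) (concat (drop s bs))
      ≡⟨ cong (λ ms → take (sum (take t ms)) (concat (drop s bs))) (drop-map s bs) ⟩
    take (sum (take t (map length (drop s bs)))) (concat (drop s bs))
      ≡⟨ take-concat t (drop s bs) ⟩
    concat (take t (drop s bs))
      ≡⟨ cong (λ k → concat (take k (drop s bs))) (m+n∸m≡n s t) ⟨
    concat (factor bs (suc s) (s + t)) ∎

length-concat : (bs : List (List A)) → length (concat bs) ≡ sum (map length bs)
length-concat []       = refl
length-concat (b ∷ bs) = trans (length-++ b) (cong (length b +_) (length-concat bs))

++-injective : (xs ys : List A) {zs ws : List A} → length xs ≡ length ys → xs ++ zs ≡ ys ++ ws → xs ≡ ys × zs ≡ ws
++-injective []       []       _ eq = refl , eq
++-injective (x ∷ xs) (y ∷ ys) l eq with ∷-injective eq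
... | refl , eq′ with ++-injective xs ys (suc-injective l) eq′
...   | refl , rest = refl , rest

concat-injective : (xs ys : List (List A)) → map length xs ≡ map length ys → concat xs ≡ concat ys → xs ≡ ys
concat-injective []       []       _ _  = refl
concat-injective (x ∷ xs) (y ∷ ys) l eq with ++-injective x y (∷-injectiveˡ l) eq
... | refl , rest = cong (x ∷_) (concat-injective xs ys (∷-injectiveʳ l) rest)

reverse-concat : (bs : List (List A)) → reverse (concat bs) ≡ concat (reverse (map reverse bs))
reverse-concat []       = refl
reverse-concat (b ∷ bs) = begin
  reverse (b ++ concat bs)                                 ≡⟨ reverse-++ b (concat bs) ⟩
  reverse (concat bs) ++ reverse b                         ≡⟨ cong₂ _++_ (reverse-concat bs) (sym (++-identityʳ (reverse b))) ⟩
  concat (reverse (map reverse bs)) ++ concat (reverse b ∷ [])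
                                                           ≡⟨ concat-++ (reverse (map reverse bs)) _ ⟩
  concat (reverse (map reverse bs) ∷ʳ reverse b)           ≡⟨ cong concat (unfold-reverse (reverse b) (map reverse bs)) ⟨
  concat (reverse (map reverse (b ∷ bs)))                  ∎
  where open ≡-Reasoning

factor-map : (f : A → B) (w : List A) (i j : ℕ) → factor (map f w) i j ≡ map f (factor w i j)
factor-map f w i j = trans (cong (take (suc j ∸ i)) (drop-map (i ∸ 1) w)) (take-map (suc j ∸ i) (drop (i ∸ 1) w))

factor-singleton : (xs : List A) {y : A} {ys : List A} →
  factor (xs ++ y ∷ ys) (suc (length xs)) (suc (length xs)) ≡ y ∷ []
factor-singleton []       = refl
factor-singleton (x ∷ xs) = factor-singleton xs

module _ {R : A → B → Set} where

  take⁺ : ∀ n {xs ys} → Pointwise R xs ys → Pointwise R (take n xs) (take n ys)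
  take⁺ zero    _        = []
  take⁺ (suc n) []       = []
  take⁺ (suc n) (r ∷ rs) = r ∷ take⁺ n rs

  drop⁺ : ∀ n {xs ys} → Pointwise R xs ys → Pointwise R (drop n xs) (drop n ys)
  drop⁺ zero    rs       = rs
  drop⁺ (suc n) []       = []
  drop⁺ (suc n) (r ∷ rs) = drop⁺ n rs

  factor⁺ : ∀ i j {xs ys} → Pointwise R xs ys → Pointwise R (factor xs i j) (factor ys i j)
  factor⁺ i j rs = take⁺ (suc j ∸ i) (drop⁺ (i ∸ 1) rs)

split-alongside : (xs : List A) {x : A} {ys : List A} (zs : List B) → length zs ≡ length (xs ++ x ∷ ys) →
  ∃[ zs₁ ] ∃[ z ] ∃[ zs₂ ] zs ≡ zs₁ ++ z ∷ zs₂ × length zs₁ ≡ length xs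
split-alongside []       (z ∷ zs) _   = [] , z , zs , refl , refl
split-alongside (x ∷ xs) (z ∷ zs) len with split-alongside xs zs (suc-injective len)
... | zs₁ , z′ , zs₂ , refl , len₁ = z ∷ zs₁ , z′ , zs₂ , refl , cong suc len₁

map-≡⇒length-≡ : {f : A → C} {g : B → C} (xs : List A) (ys : List B) → map f xs ≡ map g ys → length xs ≡ length ys
map-≡⇒length-≡ {f = f} {g} xs ys eq = trans (sym (length-map f xs)) (trans (cong length eq) (length-map g ys))

chunks : List ℕ → List A → List (List A)
chunks []       v = []
chunks (n ∷ ns) v = take n v ∷ chunks ns (drop n v)

length-take-chunk : ∀ n ns (v : List A) → length v ≡ n + sum ns → length (take n v) ≡ n
length-take-chunk n ns v len =
  trans (length-take n v) (m≤n⇒m⊓n≡m (subst (n ≤_) (sym len) (m≤m+n n (sum ns))))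

length-drop-chunk : ∀ n ns (v : List A) → length v ≡ n + sum ns → length (drop n v) ≡ sum ns
length-drop-chunk n ns v len = trans (length-drop n v) (trans (cong (_∸ n) len) (m+n∸m≡n n (sum ns)))

map-length-chunks : ∀ ns (v : List A) → length v ≡ sum ns → map length (chunks ns v) ≡ ns
map-length-chunks []       v len = refl
map-length-chunks (n ∷ ns) v len =
  cong₂ _∷_ (length-take-chunk n ns v len) (map-length-chunks ns (drop n v) (length-drop-chunk n ns v len))

concat-chunks : ∀ ns (v : List A) → length v ≡ sum ns → concat (chunks ns v) ≡ v
concat-chunks []       []      len = refl
concat-chunks (n ∷ ns) v       len =
  trans (cong (take n v ++_) (concat-chunks ns (drop n v) (length-drop-chunk n ns v len))) (take++drop≡id n v)

-- Palindromes of blocks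

palindrome-map : (f : A → B) {w : List A} → Palindrome w → Palindrome (map f w)
palindrome-map f {w} pal = trans (sym (reverse-map f w)) (cong (map f) pal)

palindrome-concatMap : (f : A → List B) → (∀ x → Palindrome (f x)) → {w : List A} → Palindrome w →
  Palindrome (concatMap f w)
palindrome-concatMap f pal-f {w} pal = begin
  reverse (concat (map f w))                ≡⟨ reverse-concat (map f w) ⟩
  concat (reverse (map reverse (map f w)))  ≡⟨ cong (concat ∘ reverse) (trans (sym (map-∘ w)) (map-cong pal-f w)) ⟩
  concat (reverse (map f w))                ≡⟨ cong concat (palindrome-map f pal) ⟩
  concat (map f w)                          ∎
  where open ≡-Reasoning

replicate-∷ʳ : ∀ n (x : A) → replicate n x ∷ʳ x ≡ x ∷ replicate n x
replicate-∷ʳ zero    x = refl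
replicate-∷ʳ (suc n) x = cong (x ∷_) (replicate-∷ʳ n x)

palindrome-replicate : ∀ n (x : A) → Palindrome (replicate n x)
palindrome-replicate zero    x = refl
palindrome-replicate (suc n) x = begin
  reverse (x ∷ replicate n x)  ≡⟨ unfold-reverse x (replicate n x) ⟩
  reverse (replicate n x) ∷ʳ x ≡⟨ cong (_∷ʳ x) (palindrome-replicate n x) ⟩
  replicate n x ∷ʳ x           ≡⟨ replicate-∷ʳ n x ⟩
  x ∷ replicate n x            ∎
  where open ≡-Reasoning

TwistedPalindrome : (A → A) → List A → Set
TwistedPalindrome σ ys = reverse (map σ ys) ≡ ys

palindrome-concat⇒twisted : (bs : List (List A)) → Palindrome (concat bs) → Palindrome (map length bs) →
  TwistedPalindrome reverse bs
palindrome-concat⇒twisted bs pal-concat pal-lengths =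
  concat-injective _ _ lengths (trans (sym (reverse-concat bs)) pal-concat)
  where
  open ≡-Reasoning
  lengths : map length (reverse (map reverse bs)) ≡ map length bs
  lengths = begin
    map length (reverse (map reverse bs))  ≡⟨ reverse-map length (map reverse bs) ⟩
    reverse (map length (map reverse bs))  ≡⟨ cong reverse (trans (sym (map-∘ bs)) (map-cong length-reverse bs)) ⟩
    reverse (map length bs)                ≡⟨ pal-lengths ⟩
    map length bs                          ∎

headOr : A → List A → A
headOr b₀ []      = b₀
headOr b₀ (b ∷ _) = b

all≡⇒replicate : {y : A} {ys : List A} → All (y ≡_) ys → ys ≡ replicate (length ys) y
all≡⇒replicate []          = refl
all≡⇒replicate (refl ∷ ps) = cong (_ ∷_) (all≡⇒replicate ps)

allEqual⇒replicate : (b₀ : A) {b : List A} → AllPairs _≡_ b → b ≡ replicate (length b) (headOr b₀ b)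
allEqual⇒replicate b₀ []      = refl
allEqual⇒replicate b₀ (p ∷ _) = cong (_ ∷_) (all≡⇒replicate p)

allEqual⇒palindrome : {b : List A} → AllPairs _≡_ b → Palindrome b
allEqual⇒palindrome {b = []}     _  = refl
allEqual⇒palindrome {b = y ∷ ys} eq = subst Palindrome (sym (allEqual⇒replicate y eq)) (palindrome-replicate _ y)

-- Expanding letters into blocks

sum-take-< : ∀ ns s j → All (1 ≤_) ns → s < j → j ≤ length ns → suc (sum (take s ns)) ≤ sum (take j ns)
sum-take-< (n ∷ ns) zero    (suc j) (1≤n ∷ _)    _         _         = ≤-trans 1≤n (m≤m+n n _)
sum-take-< (n ∷ ns) (suc s) (suc j) (_ ∷ pos) (s≤s s<j) (s≤s j≤len) =
  subst (_≤ n + sum (take j ns)) (+-suc n _) (+-monoʳ-≤ n (sum-take-< ns s j pos s<j j≤len))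

sum-take-≤ : ∀ ns j → sum (take j ns) ≤ sum ns
sum-take-≤ ns       zero    = z≤n
sum-take-≤ []       (suc j) = z≤n
sum-take-≤ (n ∷ ns) (suc j) = +-monoʳ-≤ n (sum-take-≤ ns j)

Windows : ℕ → List (ℕ × ℕ) → Set
Windows n S = ∀ {p} → p ∈ S → InS n p

blockWindow : List ℕ → ℕ × ℕ → ℕ × ℕ
blockWindow ns (i , j) = suc (sum (take (i ∸ 1) ns)) , sum (take j ns)

blockWindow-InS : ∀ ns {p} → All (1 ≤_) ns → InS (length ns) p → InS (sum ns) (blockWindow ns p)
blockWindow-InS ns {suc s , j} pos (s≤s z≤n , i≤j , j≤len) = s≤s z≤n , sum-take-< ns s j pos i≤j j≤len , sum-take-≤ ns j

expand : (A → ℕ) → List A → List A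
expand m = concatMap (λ x → replicate (m x) x)

Forces : List (ℕ × ℕ) → List A → Set₁
Forces {A} S u = ∀ (B : Set) → B → (v : List B) → length v ≡ length u → PalOn S v → Σ (A → B) λ c → map c u ≡ v

module _ (m : A → ℕ) where

  map-length-blocks : (u : List A) → map length (map (λ x → replicate (m x) x) u) ≡ map m u
  map-length-blocks u = trans (sym (map-∘ u)) (map-cong (λ x → length-replicate (m x)) u)

  length-expand : (u : List A) → length (expand m u) ≡ sum (map m u)
  length-expand u = trans (length-concat (map (λ x → replicate (m x) x) u)) (cong sum (map-length-blocks u))

  factor-expand : (u : List A) {i j : ℕ} → 1 ≤ i → i ≤ j →
    factor (expand m u) (suc (sum (take (i ∸ 1) (map m u)))) (sum (take j (map m u))) ≡ expand m (factor u i j)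
  factor-expand u {i} {j} 1≤i i≤j =
    trans (subst (λ ns → factor (expand m u) (suc (sum (take (i ∸ 1) ns))) (sum (take j ns)) ≡ concat (factor bs i j))
                 (map-length-blocks u) (factor-concat bs 1≤i i≤j))
          (cong concat (factor-map (λ x → replicate (m x) x) u i j))
    where bs = map (λ x → replicate (m x) x) u

  expand-Windows : (∀ x → 1 ≤ m x) → {u : List A} {S : List (ℕ × ℕ)} →
    Windows (length u) S → Windows (length (expand m u)) (map (blockWindow (map m u)) S)
  expand-Windows m-pos {u} windows p∈ with ∈-map⁻ (blockWindow (map m u)) p∈
  ... | q , q∈S , refl =
    subst (λ n → InS n (blockWindow (map m u) q)) (sym (length-expand u))
      (blockWindow-InS (map m u) (Allₚ.map⁺ (All.universal m-pos u))
        (subst (λ n → InS n q) (sym (length-map m u)) (windows q∈S)))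

  expand-PalOn : {u : List A} {S : List (ℕ × ℕ)} → Windows (length u) S → PalOn S u →
    PalOn (map (blockWindow (map m u)) S) (expand m u)
  expand-PalOn {u} windows pal p∈ with ∈-map⁻ (blockWindow (map m u)) p∈
  ... | (i , j) , q∈S , refl with windows q∈S
  ...   | 1≤i , i≤j , _ =
    subst Palindrome (sym (factor-expand u 1≤i i≤j))
      (palindrome-concatMap (λ x → replicate (m x) x) (λ x → palindrome-replicate (m x) x) (pal q∈S))

  expand-twisted : {S : List (ℕ × ℕ)} {u : List A} → Windows (length u) S → PalOn S u →
    (vs : List (List B)) → map length vs ≡ map m u → PalOn (map (blockWindow (map m u)) S) (concat vs) →
    ∀ {q} → q ∈ S → TwistedPalindrome reverse (factor vs (proj₁ q) (proj₂ q))
  expand-twisted {u = u} windows pal vs lengths pal-v {i , j} q∈S with windows q∈S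
  ... | 1≤i , i≤j , _ = palindrome-concat⇒twisted (factor vs i j) pal-concat pal-lengths
    where
    pal-concat : Palindrome (concat (factor vs i j))
    pal-concat = subst Palindrome (factor-concat vs 1≤i i≤j)
      (subst (λ ns → Palindrome (factor (concat vs) (suc (sum (take (i ∸ 1) ns))) (sum (take j ns))))
             (sym lengths) (pal-v (∈-map⁺ (blockWindow (map m u)) q∈S)))
    pal-lengths : Palindrome (map length (factor vs i j))
    pal-lengths = subst Palindrome (sym window-lengths) (palindrome-map m (pal q∈S))
      where
      window-lengths : map length (factor vs i j) ≡ map m (factor u i j)
      window-lengths = begin
        map length (factor vs i j)  ≡⟨ factor-map length vs i j ⟨
        factor (map length vs) i j  ≡⟨ cong (λ ns → factor ns i j) lengths ⟩
        factor (map m u) i j        ≡⟨ factor-map m u i j ⟩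
        map m (factor u i j)        ∎
        where open ≡-Reasoning

  expand-forced : {S : List (ℕ × ℕ)} {u : List A} → Forces S u → (b₀ : B) (vs : List (List B)) →
    map length vs ≡ map m u → All (AllPairs _≡_) vs →
    (∀ {q} → q ∈ S → TwistedPalindrome reverse (factor vs (proj₁ q) (proj₂ q))) →
    Σ (A → B) λ c → map c (expand m u) ≡ concat vs
  expand-forced {B = B} {S} {u} forces b₀ vs lengths constant twisted = c , (begin
    map c (concat (map rep u))                    ≡⟨ concat-map (map rep u) ⟨
    concat (map (map c) (map rep u))              ≡⟨ cong concat (trans (sym (map-∘ u)) (map-cong (λ x → map-replicate c (m x) x) u)) ⟩
    concat (map (λ x → replicate (m x) (c x)) u)  ≡⟨ cong concat (replicated u vs (proj₂ forced) lengths constant) ⟩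
    concat vs                                     ∎)
    where
    open ≡-Reasoning
    rep : A → List A
    rep x = replicate (m x) x

    heads : List B
    heads = map (headOr b₀) vs

    heads-PalOn : PalOn S heads
    heads-PalOn {i , j} q∈S = subst Palindrome (sym (factor-map (headOr b₀) vs i j)) (palindrome-map (headOr b₀) pal)
      where
      blocks-palindromic : map reverse (factor vs i j) ≡ factor vs i j
      blocks-palindromic = map-id-local (All.map allEqual⇒palindrome (Allₚ.take⁺ (suc j ∸ i) (Allₚ.drop⁺ (i ∸ 1) constant)))
      pal : Palindrome (factor vs i j)
      pal = trans (cong reverse (sym blocks-palindromic)) (twisted q∈S)

    length-heads : length heads ≡ length u
    length-heads = trans (length-map _ vs) (map-≡⇒length-≡ vs u lengths)

    forced = forces B b₀ heads length-heads heads-PalOn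
    c = proj₁ forced

    replicated : ∀ u vs → map c u ≡ map (headOr b₀) vs → map length vs ≡ map m u → All (AllPairs _≡_) vs →
      map (λ x → replicate (m x) (c x)) u ≡ vs
    replicated []      []       _  _  _            = refl
    replicated (x ∷ u) (b ∷ vs) hs ls (eq ∷ eqs) =
      cong₂ _∷_ (trans (cong₂ replicate (sym (∷-injectiveˡ ls)) (∷-injectiveˡ hs)) (sym (allEqual⇒replicate b₀ eq)))
                (replicated u vs (∷-injectiveʳ hs) (∷-injectiveʳ ls) eqs)

-- Closing a Boolean marking under reflections

_⊑_ : List Bool → List Bool → Set
_⊑_ = Pointwise _≤ᵇ_

⊑-refl : ∀ {R} → R ⊑ R
⊑-refl = Pointwiseₚ.refl Bool.≤-refl

⊑-trans : ∀ {R R′ R″} → R ⊑ R′ → R′ ⊑ R″ → R ⊑ R″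
⊑-trans = Pointwiseₚ.transitive Bool.≤-trans

⊑-antisym : ∀ {R R′} → R ⊑ R′ → R′ ⊑ R → R ≡ R′
⊑-antisym p q = Pointwise-≡⇒≡ (Pointwiseₚ.antisymmetric Bool.≤-antisym p q)

falses : List Bool → ℕ
falses []          = 0
falses (false ∷ R) = suc (falses R)
falses (true ∷ R)  = falses R

falses-antitone : ∀ {R R′} → R ⊑ R′ → falses R′ ≤ falses R
falses-antitone []                 = z≤n
falses-antitone (f≤t ∷ rs)         = m≤n⇒m≤1+n (falses-antitone rs)
falses-antitone (b≤b {false} ∷ rs) = s≤s (falses-antitone rs)
falses-antitone (b≤b {true} ∷ rs)  = falses-antitone rs

falses-< : ∀ {R R′} → R ⊑ R′ → R ≢ R′ → falses R′ < falses R
falses-< []                 R≢R′ = ⊥-elim (R≢R′ refl)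
falses-< (f≤t ∷ rs)         _    = s≤s (falses-antitone rs)
falses-< (b≤b {false} ∷ rs) R≢R′ = s≤s (falses-< rs (R≢R′ ∘ cong (false ∷_)))
falses-< (b≤b {true} ∷ rs)  R≢R′ = falses-< rs (R≢R′ ∘ cong (true ∷_))

iterate-preserves : {f : A → A} (P : A → Set) → (∀ {x} → P x → P (f x)) → ∀ {x} → P x → ∀ n → P (iterate f x n)
iterate-preserves P step px zero    = px
iterate-preserves P step px (suc n) = iterate-preserves P step (step px) n

module _ (F : List Bool → List Bool) (F-inflationary : ∀ R → R ⊑ F R) where

  fixpoint-reachable : ∀ R → ∃[ n ] F (iterate F R n) ≡ iterate F R n
  fixpoint-reachable R = go R (<-wellFounded (falses R))
    where
    go : ∀ R → Acc _<_ (falses R) → ∃[ n ] F (iterate F R n) ≡ iterate F R n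
    go R (acc rec) with ≡-dec Bool._≟_ (F R) R
    ... | yes fixed = 0 , fixed
    ... | no moved with go (F R) (rec (falses-< (F-inflationary R) (moved ∘ sym)))
    ...   | n , fixed = suc n , fixed

around : ℕ → ℕ → (List A → List A) → List A → List A
around s l g xs = take s xs ++ g (take l (drop s xs)) ++ drop l (drop s xs)

around-id : ∀ s l (xs : List A) → around s l id xs ≡ xs
around-id s l xs = trans (cong (take s xs ++_) (take++drop≡id l (drop s xs))) (take++drop≡id s xs)

around⁺ : ∀ {R : A → B → Set} s l {g h xs ys} → Pointwise R xs ys →
  Pointwise R (g (take l (drop s xs))) (h (take l (drop s ys))) → Pointwise R (around s l g xs) (around s l h ys)
around⁺ s l rs window = ++⁺ (take⁺ s rs) (++⁺ window (drop⁺ l (drop⁺ s rs)))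

around-fixed : ∀ s l {g} (xs : List A) → around s l g xs ≡ xs → g (take l (drop s xs)) ≡ take l (drop s xs)
around-fixed s l {g} xs fixed =
  ++-cancelʳ rest (g window) window (++-cancelˡ (take s xs) _ _ (trans fixed (sym (around-id s l xs))))
  where
  window = take l (drop s xs)
  rest = drop l (drop s xs)

⊑-∨ˡ : ∀ {f g} → length f ≡ length g → f ⊑ zipWith _∨_ f g
⊑-∨ˡ {[]}    {[]}    _   = []
⊑-∨ˡ {x ∷ f} {y ∷ g} len = ≤-∨ x y ∷ ⊑-∨ˡ (suc-injective len)
  where
  ≤-∨ : ∀ x y → x ≤ᵇ x ∨ y
  ≤-∨ false false = b≤b
  ≤-∨ false true  = f≤t
  ≤-∨ true  _     = b≤b

⊑-∨ʳ : ∀ {f g} → length f ≡ length g → g ⊑ zipWith _∨_ f g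
⊑-∨ʳ {[]}    {[]}    _   = []
⊑-∨ʳ {x ∷ f} {y ∷ g} len = ≤-∨ x y ∷ ⊑-∨ʳ (suc-injective len)
  where
  ≤-∨ : ∀ x y → y ≤ᵇ x ∨ y
  ≤-∨ false _     = b≤b
  ≤-∨ true  false = f≤t
  ≤-∨ true  true  = b≤b

mirror : List Bool → List Bool
mirror f = zipWith _∨_ f (reverse f)

mirror-inflationary : ∀ f → f ⊑ mirror f
mirror-inflationary f = ⊑-∨ˡ (sym (length-reverse f))

mirror-fixed⇒palindrome : ∀ f → mirror f ≡ f → Palindrome f
mirror-fixed⇒palindrome f fixed = ⊑-antisym reverse⊑f f⊑reverse
  where
  reverse⊑f : reverse f ⊑ f
  reverse⊑f = subst (reverse f ⊑_) fixed (⊑-∨ʳ (sym (length-reverse f)))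
  f⊑reverse : f ⊑ reverse f
  f⊑reverse = subst (_⊑ reverse f) (reverse-involutive f) (reverse⁺ reverse⊑f)

mirrorOn : ℕ × ℕ → List Bool → List Bool
mirrorOn (i , j) = around (i ∸ 1) (suc j ∸ i) mirror

mirrorOn-inflationary : ∀ q R → R ⊑ mirrorOn q R
mirrorOn-inflationary (i , j) R =
  subst (_⊑ mirrorOn (i , j) R) (around-id (i ∸ 1) (suc j ∸ i) R)
    (around⁺ (i ∸ 1) (suc j ∸ i) {g = id} {h = mirror} ⊑-refl (mirror-inflationary (factor R i j)))

mirrorAll : List (ℕ × ℕ) → List Bool → List Bool
mirrorAll S R = foldr mirrorOn R S

mirrorAll-inflationary : ∀ S R → R ⊑ mirrorAll S R
mirrorAll-inflationary []      R = ⊑-refl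
mirrorAll-inflationary (q ∷ S) R = ⊑-trans (mirrorAll-inflationary S R) (mirrorOn-inflationary q _)

mirrorOn-fixed⇒palindrome : ∀ q R → mirrorOn q R ≡ R → Palindrome (factor R (proj₁ q) (proj₂ q))
mirrorOn-fixed⇒palindrome (i , j) R fixed = mirror-fixed⇒palindrome (factor R i j) (around-fixed (i ∸ 1) (suc j ∸ i) {g = mirror} R fixed)

mirrorAll-fixed-tail : ∀ q S R → mirrorAll (q ∷ S) R ≡ R → mirrorAll S R ≡ R
mirrorAll-fixed-tail q S R fixed =
  ⊑-antisym (subst (mirrorAll S R ⊑_) fixed (mirrorOn-inflationary q _)) (mirrorAll-inflationary S R)

mirrorAll-fixed⇒PalOn : ∀ S R → mirrorAll S R ≡ R → PalOn S R
mirrorAll-fixed⇒PalOn (q ∷ S) R fixed (here refl) =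
  mirrorOn-fixed⇒palindrome q R (subst (λ R′ → mirrorOn q R′ ≡ R) (mirrorAll-fixed-tail q S R fixed) fixed)
mirrorAll-fixed⇒PalOn (q ∷ S) R fixed (there p∈S) =
  mirrorAll-fixed⇒PalOn S R (mirrorAll-fixed-tail q S R fixed) p∈S

Marked : {Y : Set} → (Y → Set) → List Bool → List Y → Set
Marked P = Pointwise (λ r y → T r → P y)

unmarked : {Y : Set} (P : Y → Set) (ys : List Y) → Marked P (map (λ _ → false) ys) ys
unmarked P []       = []
unmarked P (y ∷ ys) = (λ ()) ∷ unmarked P ys

∨-Marked : {Y : Set} {P : Y → Set} {f g : List Bool} {ys : List Y} →
  Marked P f ys → Marked P g ys → Marked P (zipWith _∨_ f g) ys
∨-Marked                    []       []       = []
∨-Marked {f = true ∷ _}  (m ∷ ms) (_ ∷ ns) = m ∷ ∨-Marked ms ns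
∨-Marked {f = false ∷ _} (_ ∷ ms) (n ∷ ns) = n ∷ ∨-Marked ms ns

module _ {Y : Set} {P : Y → Set} {σ : Y → Y} (σ-preserves : ∀ {y} → P y → P (σ y)) where

  reverse-Marked : ∀ {f ys} → TwistedPalindrome σ ys → Marked P f ys → Marked P (reverse f) ys
  reverse-Marked {f} {ys} twisted m = subst (Marked P (reverse f)) (trans (reverse-map σ ys) twisted) σ-reversed
    where
    σ-reversed : Marked P (reverse f) (map σ (reverse ys))
    σ-reversed = subst (λ g → Marked P g (map σ (reverse ys))) (map-id (reverse f))
      (Pointwise.map⁺ id σ (Pointwise.map (σ-preserves ∘_) (reverse⁺ m)))

  mirrorOn-Marked : ∀ q {R ys} → TwistedPalindrome σ (factor ys (proj₁ q) (proj₂ q)) →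
    Marked P R ys → Marked P (mirrorOn q R) ys
  mirrorOn-Marked (i , j) {R} {ys} twisted m =
    subst (Marked P (mirrorOn (i , j) R)) (around-id (i ∸ 1) (suc j ∸ i) ys)
      (around⁺ (i ∸ 1) (suc j ∸ i) {g = mirror} {h = id} m (∨-Marked window (reverse-Marked twisted window)))
    where window = factor⁺ i j m

  mirrorAll-Marked : ∀ S {R ys} → (∀ {q} → q ∈ S → TwistedPalindrome σ (factor ys (proj₁ q) (proj₂ q))) →
    Marked P R ys → Marked P (mirrorAll S R) ys
  mirrorAll-Marked []      twisted m = m
  mirrorAll-Marked (q ∷ S) twisted m = mirrorOn-Marked q (twisted (here refl)) (mirrorAll-Marked S (twisted ∘ there) m)

  marking-closure : ∀ S {ys} → (∀ {q} → q ∈ S → TwistedPalindrome σ (factor ys (proj₁ q) (proj₂ q))) →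
    ∀ {R₀} → Marked P R₀ ys → ∃[ R ] R₀ ⊑ R × PalOn S R × Marked P R ys
  marking-closure S {ys} twisted {R₀} m₀ =
    let n , fixed = fixpoint-reachable (mirrorAll S) (mirrorAll-inflationary S) R₀ in
    iterate (mirrorAll S) R₀ n ,
    iterate-preserves (R₀ ⊑_) (λ R₀⊑R → ⊑-trans R₀⊑R (mirrorAll-inflationary S _)) ⊑-refl n ,
    mirrorAll-fixed⇒PalOn S _ fixed ,
    iterate-preserves (λ R → Marked P R ys) (mirrorAll-Marked S twisted) m₀ n

⊑-true-at : (xs : List Bool) {ys : List Bool} (pre : List A) {a : A} {post : List A} {c : A → Bool} →
  length xs ≡ length pre → (xs ++ true ∷ ys) ⊑ map c (pre ++ a ∷ post) → c a ≡ true
⊑-true-at []       []        _   (true≤ca ∷ _) = sym (Bool.≤-antisym true≤ca (Bool.≤-maximum _))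
⊑-true-at (_ ∷ xs) (_ ∷ pre) len (_ ∷ rest)    = ⊑-true-at xs pre (suc-injective len) rest

anchor-propagation : {S : List (ℕ × ℕ)} {u : List A} → Forces S u → (vs : List (List B)) → length vs ≡ length u →
  (∀ {q} → q ∈ S → TwistedPalindrome reverse (factor vs (proj₁ q) (proj₂ q))) →
  ∀ pre {a} post → u ≡ pre ++ a ∷ post → (suc (length pre) , suc (length pre)) ∈ S →
  Pointwise (λ x b → x ≡ a → Palindrome b) u vs
anchor-propagation {S = S} {u} forces vs len twisted pre {a} post refl anchor∈S
  with split-alongside pre vs len
... | vpre , b , vpost , refl , len-vpre =
  Pointwise.map (λ marked x≡a → marked (subst (T ∘ c) (sym x≡a) (subst T (sym c-a) tt)))
    (Pointwise.map⁻ c id (subst₂ (Marked Palindrome) (sym c-u) (sym (map-id vs)) marked))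
  where
  L = length pre

  anchor-palindrome : Palindrome b
  anchor-palindrome = ∷-injectiveˡ (subst (TwistedPalindrome reverse) window (twisted anchor∈S))
    where
    window : factor vs (suc L) (suc L) ≡ b ∷ []
    window = subst (λ n → factor vs (suc n) (suc n) ≡ b ∷ []) len-vpre (factor-singleton vpre)

  R₀ : List Bool
  R₀ = map (λ _ → false) vpre ++ true ∷ map (λ _ → false) vpost

  marked₀ : Marked Palindrome R₀ vs
  marked₀ = ++⁺ (unmarked Palindrome vpre) ((λ _ → anchor-palindrome) ∷ unmarked Palindrome vpost)

  closure = marking-closure (cong reverse) S twisted marked₀
  R = proj₁ closure
  R₀⊑R = proj₁ (proj₂ closure)
  marked = proj₂ (proj₂ (proj₂ closure))

  forced = forces Bool true R (trans (sym (Pointwise-length R₀⊑R)) (trans (Pointwise-length marked₀) len))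
                  (proj₁ (proj₂ (proj₂ closure)))
  c = proj₁ forced
  c-u = proj₂ forced

  c-a : c a ≡ true
  c-a = ⊑-true-at (map (λ _ → false) vpre) pre (trans (length-map _ vpre) len-vpre)
                  (subst (R₀ ⊑_) (sym c-u) R₀⊑R)

-- Doubling one letter

module Doubling {k : ℕ} (a : Alphabet k) where

  open import Data.List.Membership.DecPropositional (_≟ᶠ_ {suc k}) using (_∈?_)

  multiplicity : Alphabet k → ℕ
  multiplicity x = if does (x ≟ᶠ a) then 2 else 1

  d≡expand : ∀ u → d a u ≡ expand multiplicity u
  d≡expand u = cong concat (map-cong doubled u)
    where
    doubled : ∀ x → (if does (x ≟ᶠ a) then x ∷ x ∷ [] else x ∷ []) ≡ replicate (multiplicity x) x
    doubled x with does (x ≟ᶠ a)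
    ... | true  = refl
    ... | false = refl

  multiplicity-pos : ∀ x → 1 ≤ multiplicity x
  multiplicity-pos x with does (x ≟ᶠ a)
  ... | true  = s≤s z≤n
  ... | false = s≤s z≤n

  block-allEqual : ∀ {B : Set} x (b : List B) → length b ≡ multiplicity x → (x ≡ a → Palindrome b) → AllPairs _≡_ b
  block-allEqual x b len pal with x ≟ᶠ a
  block-allEqual x (y ∷ z ∷ []) _ pal | yes x≡a = (sym (∷-injectiveˡ (pal x≡a)) ∷ []) ∷ [] ∷ []
  block-allEqual x (y ∷ [])     _ _   | no _    = [] ∷ []

  Anchored : List (Alphabet k) → List (ℕ × ℕ) → Set
  Anchored u S = All (a ≢_) u ⊎ ∃₂ λ pre post → u ≡ pre ++ a ∷ post × (suc (length pre) , suc (length pre)) ∈ S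

  absent-Pointwise : ∀ {B : Set} {u} → All (a ≢_) u → (vs : List (List B)) → length vs ≡ length u →
    Pointwise (λ x b → x ≡ a → Palindrome b) u vs
  absent-Pointwise []           []       _   = []
  absent-Pointwise (a≢x ∷ a∉u) (b ∷ vs) len = (λ x≡a → ⊥-elim (a≢x (sym x≡a))) ∷ absent-Pointwise a∉u vs (suc-injective len)

  doubled-blocks-palindromic : ∀ {B : Set} {u S} → Anchored u S → Forces S u → (vs : List (List B)) → length vs ≡ length u →
    (∀ {q} → q ∈ S → TwistedPalindrome reverse (factor vs (proj₁ q) (proj₂ q))) →
    Pointwise (λ x b → x ≡ a → Palindrome b) u vs
  doubled-blocks-palindromic (inj₁ a∉u)                         _      vs len _       = absent-Pointwise a∉u vs len
  doubled-blocks-palindromic (inj₂ (pre , post , u≡ , anchor∈S)) forces vs len twisted =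
    anchor-propagation forces vs len twisted pre post u≡ anchor∈S

  blocks-allEqual : ∀ {B : Set} u (vs : List (List B)) → map length vs ≡ map multiplicity u →
    Pointwise (λ x b → x ≡ a → Palindrome b) u vs → All (AllPairs _≡_) vs
  blocks-allEqual []      []       _       []         = []
  blocks-allEqual (x ∷ u) (b ∷ vs) lengths (pal ∷ ps) =
    block-allEqual x b (∷-injectiveˡ lengths) pal ∷ blocks-allEqual u vs (∷-injectiveʳ lengths) ps

  _≟²_ : (p q : ℕ × ℕ) → Dec (p ≡ q)
  _≟²_ = ×-≡-dec _≟_ _≟_

  windowsOf : List (Alphabet k) → List (ℕ × ℕ) → List (ℕ × ℕ)
  windowsOf u S = deduplicate _≟²_ (map (blockWindow (map multiplicity u)) S)

  length-windowsOf : ∀ u S → length (windowsOf u S) ≤ length S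
  length-windowsOf u S = ≤-trans (length-deduplicate _≟²_ (map window S)) (≤-reflexive (length-map window S))
    where window = blockWindow (map multiplicity u)

  doubling-generates : ∀ {u S} → Windows (length u) S → PalOn S u → Forces S u → Anchored u S →
    PalGenerates (windowsOf u S) (d a u)
  doubling-generates {u} {S} windows pal forces anchored =
    subst (PalGenerates (windowsOf u S)) (sym (d≡expand u))
      ( deduplicate-! _≟²_ _
      , (λ p∈ → expand-Windows multiplicity multiplicity-pos windows (∈-deduplicate⁻ _≟²_ _ p∈))
      , (λ p∈ → expand-PalOn multiplicity windows pal (∈-deduplicate⁻ _≟²_ _ p∈))
      , forced )
    where
    forced : Forces (windowsOf u S) (expand multiplicity u)
    forced B b₀ v len pal-v = proj₁ c , trans (proj₂ c) v-blocks
      where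
      ns = map multiplicity u
      len′ = trans len (length-expand multiplicity u)
      vs = chunks ns v
      v-blocks : concat vs ≡ v
      v-blocks = concat-chunks ns v len′
      lengths = map-length-chunks ns v len′
      twisted = expand-twisted multiplicity windows pal vs lengths
        (λ {p} p∈ → subst (λ w → Palindrome (factor w (proj₁ p) (proj₂ p))) (sym v-blocks) (pal-v (∈-deduplicate⁺ _≟²_ p∈)))
      constant = blocks-allEqual u vs lengths
        (doubled-blocks-palindromic anchored forces vs (map-≡⇒length-≡ vs u lengths) twisted)
      c = expand-forced multiplicity forces b₀ vs lengths constant twisted

  anchor-extension : ∀ u S → Windows (length u) S → PalOn S u → Forces S u →
    ∃[ S₀ ] Windows (length u) S₀ × PalOn S₀ u × Forces S₀ u × Anchored u S₀ × length S₀ ≤ suc (length S)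
  anchor-extension u S windows pal forces with a ∈? u
  ... | no a∉u = S , windows , pal , forces , inj₁ (Allₚ.¬Any⇒All¬ u a∉u) , n≤1+n _
  ... | yes a∈u with ∈-∃++ a∈u
  ...   | pre , post , refl = (p , p) ∷ S , windows₀ , pal₀ , forces₀ , inj₂ (pre , post , refl , here refl) , ≤-refl
    where
    p = suc (length pre)
    windows₀ : Windows (length u) ((p , p) ∷ S)
    windows₀ (here refl) = s≤s z≤n , ≤-refl , subst (p ≤_) (sym (length-++ pre)) (m<m+n (length pre) (s≤s z≤n))
    windows₀ (there q∈S) = windows q∈S
    pal₀ : PalOn ((p , p) ∷ S) u
    pal₀ (here refl) = subst Palindrome (sym (factor-singleton pre)) refl
    pal₀ (there q∈S) = pal q∈S
    forces₀ : Forces ((p , p) ∷ S) u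
    forces₀ B b₀ v len pal-v = forces B b₀ v len (pal-v ∘ there)

open Doubling using (windowsOf; length-windowsOf; doubling-generates; anchor-extension)

corollary2 : {k : ℕ} (a : Alphabet k) (u : List (Alphabet k)) (m : ℕ) →
    μ≤ u m → μ≤ (d a u) (suc m)
corollary2 a u m (S , (_ , windows , pal , forces) , |S|≤m) with anchor-extension a u S windows pal forces
... | S₀ , windows₀ , pal₀ , forces₀ , anchored , |S₀|≤1+|S| =
  windowsOf a u S₀ ,
  doubling-generates a windows₀ pal₀ forces₀ anchored ,
  ≤-trans (length-windowsOf a u S₀) (≤-trans |S₀|≤1+|S| (s≤s |S|≤m))
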